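{- Let $\sigma,\tau\in S_3$. For every $n\ge 1$ and every $\pi\in S_n$, the last entry of $s_{\sigma,\tau}(\pi)$ is $\pi_1$, i.e. $(s_{\sigma,\tau}(\pi))_n=\pi_1$.
   Context: $S_n$ is the set of permutations of $\{1,\dots,n\}$ in one-line notation $\pi=\pi_1\cdots\pi_n$. A sequence of distinct integers contains a pattern $\rho\in S_m$ if it has a (not necessarily consecutive) subsequence whose entries are in the same relative order as $\rho$; otherwise it avoids $\rho$. For patterns $\sigma,\tau$, the map $s_{\sigma,\tau}:S_n\to S_n$ is defined as follows: the entries of $\pi$ are read from left to right, with one stack (initially empty) and an output word (initially empty). At each step, if there is a remaining input entry $x$ and placing $x$ on top of the stack would produce a stack whose contents, read from top to bottom, avoid both $\sigma$ and $\tau$, then $x$ is pushed (pushing has priority); otherwise the top entry of the stack is popped and appended to the output. When the input is exhausted, the remaining stack entries are popped from the top and appended to the output. The resulting output is $s_{\sigma,\tau}(\pi)$. -}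

module Defs where

open import Data.Nat using (ℕ; suc; _<_)
open import Data.List using (List; []; _∷_; length; lookup; map; upTo)
open import Data.List.Relation.Binary.Sublist.Propositional using (_⊆_)
open import Data.List.Relation.Binary.Permutation.Propositional using (_↭_)
open import Data.Fin using (Fin; cast)
open import Data.Product using (Σ; ∃; _×_)
open import Relation.Binary.PropositionalEquality using (_≡_)
open import Relation.Nullary using (¬_)
open import Function.Bundles using (_⇔_)

-- S_n : lists that are rearrangements of 1,2,…,n (one-line notation)
IsPerm : ℕ → List ℕ → Set
IsPerm n π = π ↭ map suc (upTo n)

OrderIso : List ℕ → List ℕ → Set
OrderIso u ρ = Σ (length u ≡ length ρ) λ eq →
  ∀ (i j : Fin (length u)) →
    (lookup u i < lookup u j) ⇔ (lookup ρ (cast eq i) < lookup ρ (cast eq j))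

Contains : List ℕ → List ℕ → Set
Contains w ρ = ∃ λ u → (u ⊆ w) × OrderIso u ρ

Avoids : List ℕ → List ℕ → Set
Avoids w ρ = ¬ Contains w ρ

-- Run σ τ input stack output : running the (σ,τ)-avoiding stack from the
-- configuration (remaining input, stack) produces `output` (the rest of the
-- output word).  The stack is a list whose head is the top entry, so the
-- list read left to right is the stack read top to bottom.
data Run (σ τ : List ℕ) : List ℕ → List ℕ → List ℕ → Set where
  done     : Run σ τ [] [] []
  push     : ∀ {x xs st o} →
             Avoids (x ∷ st) σ → Avoids (x ∷ st) τ →
             Run σ τ xs (x ∷ st) o → Run σ τ (x ∷ xs) st o
  pop      : ∀ {x xs y st o} →
             ¬ (Avoids (x ∷ y ∷ st) σ × Avoids (x ∷ y ∷ st) τ) →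
             Run σ τ (x ∷ xs) st o → Run σ τ (x ∷ xs) (y ∷ st) (y ∷ o)
  pop-end  : ∀ {y st o} →
             Run σ τ [] st o → Run σ τ [] (y ∷ st) (y ∷ o)

StackSort : List ℕ → List ℕ → List ℕ → List ℕ → Set
StackSort σ τ π out = Run σ τ π [] out

{-# OPTIONS --safe #-}
-- The first entry π₁ is pushed onto the empty stack and stays at its bottom.
-- It could only be popped while it is the sole entry and some input x is
-- waiting; but then the stack x π₁ has two entries, too few to contain a
-- pattern of length 3, so pushing x has priority.  Hence π₁ leaves the stack
-- only when the input is exhausted and everything above it is gone, i.e. as
-- the last output entry.
module Submission where

open import Defs
open import Data.Nat using (ℕ; suc; _≥_; _<_; _≤_; s≤s; z≤n)
open import Data.Nat.Properties using (_<?_; _≟_; ≡-irrelevant; ≤-trans; ≤-reflexive; ≤-refl; <-irrefl)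
open import Data.List using (List; []; _∷_; [_]; head; last; length; lookup; upTo)
open import Data.List.Properties using (length-map; length-upTo)
open import Data.Maybe using (just)
open import Data.Product using (∃; _×_; _,_)
open import Data.Sum using (_⊎_; inj₁; inj₂)
open import Data.Fin using (cast)
open import Data.Fin.Properties using (all?)
open import Data.Empty using (⊥-elim)
open import Relation.Binary.PropositionalEquality using (_≡_; refl; subst; sym; trans)
open import Relation.Nullary using (Dec; yes; no)
open import Relation.Nullary.Decidable using (map′; ¬?; _×-dec_; _⊎-dec_; _→-dec_)
open import Function.Bundles using (_⇔_; mk⇔; Equivalence)
open import Data.List.Relation.Binary.Sublist.Propositional using (_⊆_; []; _∷_; _∷ʳ_)
open import Data.List.Relation.Binary.Sublist.Heterogeneous.Properties using (length-mono-≤)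
open import Data.List.Relation.Binary.Permutation.Propositional.Properties using (↭-length)

_⇔-dec_ : {A B : Set} → Dec A → Dec B → Dec (A ⇔ B)
a? ⇔-dec b? = map′ (λ (f , g) → mk⇔ f g) (λ e → Equivalence.to e , Equivalence.from e)
                   ((a? →-dec b?) ×-dec (b? →-dec a?))

order-iso? : ∀ u ρ → Dec (OrderIso u ρ)
order-iso? u ρ with length u ≟ length ρ
... | no ≢ = no λ (eq , _) → ≢ eq
... | yes eq = map′ (eq ,_) (λ (eq′ , iso) → subst SameOrder (≡-irrelevant eq′ eq) iso)
                    (all? λ i → all? λ j →
                      (lookup u i <? lookup u j) ⇔-dec (lookup ρ (cast eq i) <? lookup ρ (cast eq j)))
  where
  SameOrder : length u ≡ length ρ → Set
  SameOrder eq = ∀ i j → (lookup u i < lookup u j) ⇔ (lookup ρ (cast eq i) < lookup ρ (cast eq j))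

any-sublist? : {P : List ℕ → Set} → (∀ u → Dec (P u)) → ∀ w → Dec (∃ λ u → u ⊆ w × P u)
any-sublist? P? [] = map′ (λ p → [] , [] , p) (λ { ([] , [] , p) → p }) (P? [])
any-sublist? {P} P? (x ∷ w) = map′ join split (any-sublist? P? w ⊎-dec any-sublist? (λ u → P? (x ∷ u)) w)
  where
  join : (∃ λ u → u ⊆ w × P u) ⊎ (∃ λ u → u ⊆ w × P (x ∷ u)) → ∃ λ u → u ⊆ x ∷ w × P u
  join = λ { (inj₁ (u , s , p)) → u , x ∷ʳ s , p ; (inj₂ (u , s , p)) → x ∷ u , refl ∷ s , p }
  split : (∃ λ u → u ⊆ x ∷ w × P u) → (∃ λ u → u ⊆ w × P u) ⊎ (∃ λ u → u ⊆ w × P (x ∷ u))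
  split = λ { (u , (.x ∷ʳ s) , p) → inj₁ (u , s , p) ; ((.x ∷ u) , (refl ∷ s) , p) → inj₂ (u , s , p) }

avoids? : ∀ w ρ → Dec (Avoids w ρ)
avoids? w ρ = ¬? (any-sublist? (λ u → order-iso? u ρ) w)

length<⇒avoids : ∀ {w ρ} → length w < length ρ → Avoids w ρ
length<⇒avoids w<ρ (u , u⊆w , (eq , _)) =
  <-irrefl refl (≤-trans w<ρ (subst (_≤ _) eq (length-mono-≤ u⊆w)))

length-perm : ∀ {n ρ} → IsPerm n ρ → length ρ ≡ n
length-perm {n} ρ↭ = trans (↭-length ρ↭) (trans (length-map suc (upTo n)) (length-upTo n))

perm-avoids-shorter : ∀ {n w ρ} → IsPerm n ρ → length w < n → Avoids w ρ
perm-avoids-shorter {ρ = ρ} ρ↭ w<n = length<⇒avoids {ρ = ρ} (≤-trans w<n (≤-reflexive (sym (length-perm ρ↭))))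

Allowed : List ℕ → List ℕ → List ℕ → Set
Allowed σ τ st = Avoids st σ × Avoids st τ

allowed? : ∀ σ τ st → Dec (Allowed σ τ st)
allowed? σ τ st = avoids? st σ ×-dec avoids? st τ

data Bottom {A : Set} (b : A) : List A → Set where
  here  : Bottom b [ b ]
  there : ∀ {y st} → Bottom b st → Bottom b (y ∷ st)

last-∷ : ∀ {A : Set} {b : A} y o → last o ≡ just b → last (y ∷ o) ≡ just b
last-∷ y (_ ∷ _) eq = eq

module _ {σ τ : List ℕ} where

  drain : ∀ st → ∃ (Run σ τ [] st)
  drain [] = [] , done
  drain (y ∷ st) with drain st
  ... | o , r = y ∷ o , pop-end r

  run : (∀ x → Allowed σ τ [ x ]) → ∀ xs st → ∃ (Run σ τ xs st)
  run allowed₁ [] st = drain st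
  run allowed₁ (x ∷ xs) = feed
    where
    feed : ∀ st → ∃ (Run σ τ (x ∷ xs) st)
    feed st with allowed? σ τ (x ∷ st)
    feed st       | yes (a , b) with run allowed₁ xs (x ∷ st)
    ... | o , r = o , push a b r
    feed []       | no ¬allowed = ⊥-elim (¬allowed (allowed₁ x))
    feed (y ∷ st) | no ¬allowed with feed st
    ... | o , r = y ∷ o , pop ¬allowed r

  module _ (allowed₂ : ∀ x y → Allowed σ τ (x ∷ y ∷ [])) where

    last-output-is-bottom : ∀ {xs st o b} → Run σ τ xs st o → Bottom b st → last o ≡ just b
    last-output-is-bottom (push _ _ r)        bot         = last-output-is-bottom r (there bot)
    last-output-is-bottom (pop ¬allowed _)    here        = ⊥-elim (¬allowed (allowed₂ _ _))
    last-output-is-bottom (pop {o = o} _ r)   (there bot) = last-∷ _ o (last-output-is-bottom r bot)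
    last-output-is-bottom (pop-end done)      here        = refl
    last-output-is-bottom (pop-end {o = o} r) (there bot) = last-∷ _ o (last-output-is-bottom r bot)

    last-output-is-first-input : ∀ {π o} → Run σ τ π [] o → last o ≡ head π
    last-output-is-first-input done         = refl
    last-output-is-first-input (push _ _ r) = last-output-is-bottom r here

proposition3p1 : (σ τ : List ℕ) → IsPerm 3 σ → IsPerm 3 τ →
    (n : ℕ) → n ≥ 1 → (π : List ℕ) → IsPerm n π →
    (∃ λ out → StackSort σ τ π out) ×
    (∀ out → StackSort σ τ π out → last out ≡ head π)
proposition3p1 σ τ σ↭ τ↭ _ _ π _ =
  run (λ _ → allowed (s≤s z≤n)) π [] , λ _ → last-output-is-first-input (λ _ _ → allowed ≤-refl)
  where
  allowed : ∀ {st} → length st ≤ 2 → Allowed σ τ st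
  allowed st≤2 = perm-avoids-shorter σ↭ (s≤s st≤2) , perm-avoids-shorter τ↭ (s≤s st≤2)
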